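{- Let $(G,\omega)$ be a weighted graph and let $e$ be a non-loop edge of $G$. Then $$X_{(G/e,\omega/e)} = X_{((G,\omega)\odot e)\setminus \ell_e} - X_{(G,\omega)\odot e},$$ and the weighted chromatic symmetric function satisfies the deletion-near-contraction formula $$X_{(G,\omega)}=X_{(G\setminus e,\omega)} - X_{((G,\omega)\odot e)\setminus \ell_e} + X_{(G,\omega)\odot e}.$$ Moreover, if $G$ is simple, then $$X_{(G,\omega)}=X_{(G\setminus e,\omega)} - X_{((G,\omega)\odot e)^s\setminus \ell_e} + X_{((G,\omega)\odot e)^s}.$$
   Context: Graphs are finite and may have loops and multiple (parallel) edges; a graph is simple if it has neither. For a graph $H$, $H^s$ denotes the simple graph obtained by deleting all loops and replacing each maximal class of parallel edges by a single edge. A weighted graph is a pair $(G,\omega)$ with $\omega:V(G)\to\{1,2,3,\dots\}$; $(G,\omega)^s=(G^s,\omega)$, and $(G\setminus e,\omega)$ is obtained by deleting the edge $e$. For a non-loop edge $e=uv$, the contraction $(G/e,\omega/e)$ is obtained by deleting $e$, replacing $u,v$ by a single new vertex $v_e$ and making every other edge incident with $u$ or $v$ incident with $v_e$ instead (so other edges between $u$ and $v$ become loops), with $(\omega/e)(v_e)=\omega(u)+\omega(v)$ and all other weights unchanged. The near-contraction $(G,\omega)\odot e$ is obtained from $(G/e,\omega/e)$ by adding a new vertex $v''$ and a new edge $\ell_e=v_ev''$, giving $v''$ weight $1$ and changing the weight of $v_e$ to $\omega(u)+\omega(v)-1$ (all other weights unchanged); $((G,\omega)\odot e)\setminus\ell_e$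 deletes the edge $\ell_e$. For a weighted graph $(G,\omega)$ with vertices $v_1,\dots,v_l$, the weighted chromatic symmetric function is $X_{(G,\omega)}=\sum_{\kappa}\prod_{i=1}^l x_{\kappa(v_i)}^{\omega(v_i)}$, where $x_1,x_2,\dots$ are commuting indeterminates and the sum ranges over proper colorings $\kappa:V(G)\to\{1,2,\dots\}$, i.e. $\kappa(u)\neq\kappa(v)$ for every edge $uv$ (so $X_{(G,\omega)}=0$ if $G$ has a loop). -}

module Defs where

open import Data.Nat using (ℕ; zero; suc; _+_; _∸_; _≤_)
open import Data.Integer using (ℤ; +_)
open import Data.Fin using (Fin; zero; suc; punchOut; punchIn; _≟_)
open import Data.Fin.Properties using () renaming (_≟_ to _≟ᶠ_)
open import Data.Product using (_×_; _,_; proj₁; proj₂)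
open import Data.Bool using (Bool; true; false; _∧_; _∨_; not; if_then_else_)
open import Data.List using (List; []; _∷_; length; lookup; removeAt; filterᵇ; deduplicateᵇ; map; concatMap; allFin)
open import Data.Nat.ListAction using (sum)
open import Data.Bool.ListAction using (all)
open import Data.Vec using (Vec; []; _∷_) renaming (lookup to vlookup)
open import Relation.Nullary using (¬_; yes; no)
open import Relation.Nullary.Decidable using (⌊_⌋)
open import Relation.Binary.PropositionalEquality using (_≡_; _≢_)

-- A finite weighted multigraph (loops and parallel edges allowed):
-- vertices Fin nv, an edge list (each edge given by its two endpoints,
-- undirected), and a vertex weight function.
record WGraph : Set where
  constructor wgraph
  field
    nv    : ℕ
    edges : List (Fin nv × Fin nv)
    w     : Fin nv → ℕ
open WGraph public

PositiveWeights : WGraph → Set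
PositiveWeights G = (i : Fin (nv G)) → 1 ≤ w G i

Edge : WGraph → Set
Edge G = Fin (length (edges G))

endpoints : (G : WGraph) → Edge G → Fin (nv G) × Fin (nv G)
endpoints G e = lookup (edges G) e

NonLoop : (G : WGraph) → Edge G → Set
NonLoop G e = proj₁ (endpoints G e) ≢ proj₂ (endpoints G e)

_==_ : ∀ {n} → Fin n → Fin n → Bool
a == b = ⌊ a ≟ᶠ b ⌋

sameEdge : ∀ {n} → Fin n × Fin n → Fin n × Fin n → Bool
sameEdge (a , b) (c , d) = ((a == c) ∧ (b == d)) ∨ ((a == d) ∧ (b == c))

isLoop : ∀ {n} → Fin n × Fin n → Bool
isLoop (a , b) = a == b

Simple : WGraph → Set
Simple G = ((e : Edge G) → NonLoop G e)
         × ((e f : Edge G) → e ≢ f → sameEdge (endpoints G e) (endpoints G f) ≡ false)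

delete : (G : WGraph) → Edge G → WGraph
delete G e = wgraph (nv G) (removeAt (edges G) e) (w G)

deletePair : (G : WGraph) → Fin (nv G) × Fin (nv G) → WGraph
deletePair G p = wgraph (nv G) (filterᵇ (λ f → not (sameEdge p f)) (edges G)) (w G)

simp : WGraph → WGraph
simp G = wgraph (nv G) (deduplicateᵇ sameEdge (filterᵇ (λ f → not (isLoop f)) (edges G))) (w G)

-- Contraction of the edge e = uv (u ≠ v) in a graph with vertex set Fin (suc m):
-- the vertex v is removed (vertices re-indexed by punchOut at v) and u plays
-- the role of the merged vertex v_e = punchOut (v ≠ u).
module Contract {m : ℕ} (u v : Fin (suc m)) (v≢u : v ≢ u) where
  ve : Fin m
  ve = punchOut v≢u

  mergeV : Fin (suc m) → Fin m
  mergeV x with v ≟ᶠ x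
  ... | yes _ = ve
  ... | no v≢x = punchOut v≢x

  mergeE : Fin (suc m) × Fin (suc m) → Fin m × Fin m
  mergeE (a , b) = mergeV a , mergeV b

  wc : (Fin (suc m) → ℕ) → Fin m → ℕ
  wc ω y = if y == ve then ω u + ω v else ω (punchIn v y)

  -- weights of (G,ω) ⊙ e : new vertex v'' = zero, old vertices shifted by suc
  wn : (Fin (suc m) → ℕ) → Fin (suc m) → ℕ
  wn ω zero = 1
  wn ω (suc y) = if y == ve then (ω u + ω v) ∸ 1 else ω (punchIn v y)

  shift : Fin m × Fin m → Fin (suc m) × Fin (suc m)
  shift (a , b) = suc a , suc b

  ℓ : Fin (suc m) × Fin (suc m)
  ℓ = suc ve , zero

contraction : (G : WGraph) → (e : Edge G) → NonLoop G e → WGraph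
contraction (wgraph zero E ω) e _ with proj₁ (lookup E e)
... | ()
contraction (wgraph (suc m) E ω) e nl =
  wgraph m (map mergeE (removeAt E e)) (wc ω)
  where open Contract (proj₂ (lookup E e)) (proj₁ (lookup E e)) nl

-- near-contraction  (G,ω) ⊙ e ; the edge ℓ_e is the first edge of the list
nearContraction : (G : WGraph) → (e : Edge G) → NonLoop G e → WGraph
nearContraction (wgraph zero E ω) e _ with proj₁ (lookup E e)
... | ()
nearContraction (wgraph (suc m) E ω) e nl =
  wgraph (suc m) (ℓ ∷ map (λ f → shift (mergeE f)) (removeAt E e)) (wn ω)
  where open Contract (proj₂ (lookup E e)) (proj₁ (lookup E e)) nl

ℓ-ends : (G : WGraph) → (e : Edge G) → (nl : NonLoop G e) →
         Fin (nv (nearContraction G e nl)) × Fin (nv (nearContraction G e nl))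
ℓ-ends (wgraph zero E ω) e _ with proj₁ (lookup E e)
... | ()
ℓ-ends (wgraph (suc m) E ω) e nl = ℓ
  where open Contract (proj₂ (lookup E e)) (proj₁ (lookup E e)) nl

nearContractionMinusℓ : (G : WGraph) → (e : Edge G) → NonLoop G e → WGraph
nearContractionMinusℓ (wgraph zero E ω) e _ with proj₁ (lookup E e)
... | ()
nearContractionMinusℓ (wgraph (suc m) E ω) e nl =
  delete (nearContraction (wgraph (suc m) E ω) e nl) zero

-- A monomial of X_{(G,ω)} is x_1^{a_1} ⋯ x_n^{a_n}, recorded as (n , a : Fin n → ℕ)
-- (every monomial involves finitely many variables).  Its coefficient is the number
-- of proper colorings κ : V(G) → {1,2,…} with ∏ x_{κ(v)}^{ω(v)} equal to that
-- monomial.  Since weights are positive, such κ use only colors in Fin n, so the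
-- coefficient is the number of proper κ : V(G) → Fin n whose color classes have
-- total weights a.

allVecs : (n k : ℕ) → List (Vec (Fin n) k)
allVecs n zero = [] ∷ []
allVecs n (suc k) = concatMap (λ c → map (c ∷_) (allVecs n k)) (allFin n)

proper : (G : WGraph) → ∀ {n} → Vec (Fin n) (nv G) → Bool
proper G κ = all (λ f → not (vlookup κ (proj₁ f) == vlookup κ (proj₂ f))) (edges G)

classWeight : (G : WGraph) → ∀ {n} → Vec (Fin n) (nv G) → Fin n → ℕ
classWeight G κ c = sum (map (λ i → if vlookup κ i == c then w G i else 0) (allFin (nv G)))

_==ℕ_ : ℕ → ℕ → Bool
a ==ℕ b = ⌊ a Data.Nat.≟ b ⌋

hasMonomial : (G : WGraph) → ∀ {n} → (Fin n → ℕ) → Vec (Fin n) (nv G) → Bool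
hasMonomial G {n} a κ = all (λ c → classWeight G κ c ==ℕ a c) (allFin n)

X : WGraph → (n : ℕ) → (Fin n → ℕ) → ℤ
X G n a = + length (filterᵇ (λ κ → proper G κ ∧ hasMonomial G a κ) (allVecs n (nv G)))

module Submission where

-- Each coefficient of X is a number of proper colourings.  Splitting the colourings of
-- a graph according to whether the two ends of an edge get the same colour, and noting
-- that those where they agree are exactly the colourings of the graph with the two ends
-- identified, gives #(G \ e) = #(G/e) + #G.  The same split along the pendant edge ℓ_e
-- gives #(((G,ω) ⊙ e) \ ℓ_e) = #(G/e) + #((G,ω) ⊙ e): identifying v'' with v_e restores
-- the weight (ω(u) + ω(v) − 1) + 1, which is where positivity of the weights enters.
-- For simple G no edge of (G,ω) ⊙ e is a loop or parallel to ℓ_e, so simplification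
-- does not change which colourings are proper.

open import Defs
open import Data.Bool using (Bool; true; false; _∧_; not; if_then_else_; T)
open import Data.Bool.ListAction using (all; and)
open import Data.Bool.Properties using (∧-assoc; ∧-comm; ∨-zeroʳ; ∧-zeroʳ)
open import Data.Empty using (⊥-elim)
open import Data.Fin using (Fin; zero; suc; punchIn; punchOut)
open import Data.Fin.Properties
  using (_≟_; suc-injective; punchIn-punchOut; punchInᵢ≢i; punchOut-injective)
open import Data.Integer using (ℤ; +_; _+_; _-_)
open import Data.Integer.Properties using (pos-+)
open import Data.Integer.Tactic.RingSolver using (solve-∀)
open import Data.List
  using ( List; []; _∷_; _++_; lookup; length; map; allFin; tabulate; concatMap; removeAt
        ; filter; filterᵇ; deduplicate; deduplicateᵇ)
open import Data.List.Properties
  using (length-++; map-∘; map-cong; tabulate-lookup; filter-++; filter-accept; filter-reject; filter-all)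
open import Data.List.Relation.Unary.All as All using (All; []; _∷_)
open import Data.List.Relation.Unary.All.Properties
  using (all⁺; all⁻; deduplicate⁺; deduplicate⁻; filter⁺; tabulate⁺; map⁺)
open import Data.Nat as ℕ using (ℕ; zero; suc; _≤_)
open import Data.Nat.ListAction using (sum)
open import Data.Nat.Properties
  using (+-identityʳ; +-comm; m∸n+n≡m; ≤-trans; m≤m+n; +-0-commutativeMonoid)
open import Algebra.Properties.CommutativeMonoid.Sum +-0-commutativeMonoid
  using (sum-syntax; sum-cong-≗; ∑-distrib-+; ∑-comm; sum-remove; sum-replicate-zero)
open import Data.Product using (_×_; _,_; proj₁; proj₂)
open import Data.Sum using (_⊎_; inj₁; inj₂)
open import Data.Unit using (tt)
open import Data.Vec using (Vec; []; _∷_; insertAt) renaming (lookup to vlookup)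
open import Data.Vec.Properties using (insertAt-lookup; insertAt-punchIn)
open import Function using (_∘_; id)
open import Relation.Nullary using (¬_; Dec; yes; no; ¬?; contradiction)
open import Relation.Nullary.Decidable using (T?)
open import Relation.Binary.PropositionalEquality

==-refl : ∀ {n} (a : Fin n) → (a == a) ≡ true
==-refl a with a ≟ a
... | yes _  = refl
... | no a≢a = contradiction refl a≢a

≢⇒==-false : ∀ {n} {a b : Fin n} → a ≢ b → (a == b) ≡ false
≢⇒==-false {a = a} {b} a≢b with a ≟ b
... | yes a≡b = contradiction a≡b a≢b
... | no _    = refl

≢⇒T-not-== : ∀ {n} {a b : Fin n} → a ≢ b → T (not (a == b))
≢⇒T-not-== a≢b rewrite ≢⇒==-false a≢b = tt

==-sym : ∀ {n} (a b : Fin n) → (a == b) ≡ (b == a)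
==-sym a b with a ≟ b
... | yes refl = sym (==-refl a)
... | no a≢b   = sym (≢⇒==-false (a≢b ∘ sym))

==-suc : ∀ {n} (a b : Fin n) → (suc a == suc b) ≡ (a == b)
==-suc a b with a ≟ b
... | yes refl = refl
... | no _     = refl

==-∧-subst : ∀ {n} (f : Fin n → Bool) (c d : Fin n) → ((c == d) ∧ f c) ≡ ((c == d) ∧ f d)
==-∧-subst f c d with c ≟ d
... | yes refl = refl
... | no _     = refl

T-ext : ∀ {x y} → (T x → T y) → (T y → T x) → x ≡ y
T-ext {false} {false} _ _ = refl
T-ext {false} {true}  _ g = ⊥-elim (g tt)
T-ext {true}  {false} f _ = ⊥-elim (f tt)
T-ext {true}  {true}  _ _ = refl

T-not⇒¬T : ∀ {b} → T (not b) → ¬ T b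
T-not⇒¬T {false} _ ()

all-map : ∀ {A B : Set} (p : B → Bool) (f : A → B) (xs : List A) →
  all p (map f xs) ≡ all (p ∘ f) xs
all-map p f xs = cong and (sym (map-∘ xs))

all-cong : ∀ {A : Set} {p q : A → Bool} → (∀ x → p x ≡ q x) → (xs : List A) →
  all p xs ≡ all q xs
all-cong p≗q xs = cong and (map-cong p≗q xs)

all-removeAt : ∀ {A : Set} (p : A → Bool) (xs : List A) (i : Fin (length xs)) →
  all p xs ≡ p (lookup xs i) ∧ all p (removeAt xs i)
all-removeAt p (x ∷ xs) zero    = refl
all-removeAt p (x ∷ xs) (suc i) = begin
  p x ∧ all p xs                                   ≡⟨ cong (p x ∧_) (all-removeAt p xs i) ⟩
  p x ∧ (p (lookup xs i) ∧ all p (removeAt xs i))  ≡⟨ sym (∧-assoc (p x) _ _) ⟩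
  (p x ∧ p (lookup xs i)) ∧ all p (removeAt xs i)  ≡⟨ cong (_∧ _) (∧-comm (p x) _) ⟩
  (p (lookup xs i) ∧ p x) ∧ all p (removeAt xs i)  ≡⟨ ∧-assoc (p (lookup xs i)) (p x) _ ⟩
  p (lookup xs i) ∧ (p x ∧ all p (removeAt xs i))  ∎
  where open ≡-Reasoning

all-removeAt⁺ : ∀ {A : Set} {P : A → Set} (xs : List A) (i : Fin (length xs)) →
  (∀ j → j ≢ i → P (lookup xs j)) → All P (removeAt xs i)
all-removeAt⁺ (x ∷ xs) zero    h =
  subst (All _) (tabulate-lookup xs) (tabulate⁺ λ j → h (suc j) λ ())
all-removeAt⁺ (x ∷ xs) (suc i) h =
  h zero (λ ()) ∷ all-removeAt⁺ xs i λ j j≢i → h (suc j) (j≢i ∘ suc-injective)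

all-deduplicate : ∀ {A : Set} {R : A → A → Set} (R? : ∀ x y → Dec (R x y)) (p : A → Bool) →
  (∀ {x y} → R x y → p x ≡ p y) → ∀ xs → all p (deduplicate R? xs) ≡ all p xs
all-deduplicate R? p p-resp xs = T-ext
  (all⁻ p ∘ deduplicate⁻ R? (subst T ∘ p-resp) xs ∘ all⁺ p _)
  (all⁻ p ∘ deduplicate⁺ R? ∘ all⁺ p xs)

sameEdge-refl : ∀ {n} (a b : Fin n) → T (sameEdge (a , b) (a , b))
sameEdge-refl a b rewrite ==-refl a | ==-refl b = tt

sameEdge-flip : ∀ {n} (a b : Fin n) → T (sameEdge (a , b) (b , a))
sameEdge-flip a b rewrite ==-refl a | ==-refl b | ∨-zeroʳ ((a == b) ∧ (b == a)) = tt

sameEdge-cases : ∀ {n} (a b c d : Fin n) → T (sameEdge (a , b) (c , d)) →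
  (a ≡ c × b ≡ d) ⊎ (a ≡ d × b ≡ c)
sameEdge-cases a b c d same with a ≟ c | b ≟ d | a ≟ d | b ≟ c
... | yes a≡c | yes b≡d | _       | _       = inj₁ (a≡c , b≡d)
... | _       | _       | yes a≡d | yes b≡c = inj₂ (a≡d , b≡c)
... | no _    | _       | no _    | _       = ⊥-elim same
... | no _    | _       | yes _   | no _    = ⊥-elim same
... | yes _   | no _    | no _    | _       = ⊥-elim same
... | yes _   | no _    | yes _   | no _    = ⊥-elim same

properEdge : ∀ {n k} → Vec (Fin n) k → Fin k × Fin k → Bool
properEdge κ (a , b) = not (vlookup κ a == vlookup κ b)

properEdge-resp-sameEdge : ∀ {n k} (κ : Vec (Fin n) k) {f g} → T (sameEdge f g) →
  properEdge κ f ≡ properEdge κ g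
properEdge-resp-sameEdge κ {a , b} {c , d} same with sameEdge-cases a b c d same
... | inj₁ (refl , refl) = refl
... | inj₂ (refl , refl) = cong not (==-sym _ _)

proper-simp : ∀ H {n} (κ : Vec (Fin n) (nv H)) → All (T ∘ not ∘ isLoop) (edges H) →
  proper (simp H) κ ≡ proper H κ
proper-simp H κ loopless = trans
  (all-deduplicate (λ f g → T? (sameEdge f g)) (properEdge κ) (properEdge-resp-sameEdge κ)
                   (filterᵇ (not ∘ isLoop) (edges H)))
  (cong (all (properEdge κ)) (filter-all (T? ∘ not ∘ isLoop) loopless))

deletePair-simp-cons : ∀ k p E (ω : Fin k → ℕ) →
  T (not (isLoop p)) → All (T ∘ not ∘ sameEdge p) E →
  edges (deletePair (simp (wgraph k (p ∷ E) ω)) p) ≡ edges (simp (wgraph k E ω))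
deletePair-simp-cons k p E ω p-nonLoop E-apart = begin
  filterᵇ (not ∘ sameEdge p) (deduplicateᵇ sameEdge (filterᵇ (not ∘ isLoop) (p ∷ E)))
    ≡⟨ cong (filterᵇ (not ∘ sameEdge p) ∘ deduplicateᵇ sameEdge)
            (filter-accept (T? ∘ not ∘ isLoop) p-nonLoop) ⟩
  filterᵇ (not ∘ sameEdge p) (p ∷ filter (¬? ∘ T? ∘ sameEdge p) D)
    ≡⟨ filter-reject (T? ∘ not ∘ sameEdge p)
                     (λ t → T-not⇒¬T t (sameEdge-refl (proj₁ p) (proj₂ p))) ⟩
  filterᵇ (not ∘ sameEdge p) (filter (¬? ∘ T? ∘ sameEdge p) D)
    ≡⟨ cong (filterᵇ (not ∘ sameEdge p))
            (filter-all (¬? ∘ T? ∘ sameEdge p) (All.map T-not⇒¬T D-apart)) ⟩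
  filterᵇ (not ∘ sameEdge p) D
    ≡⟨ filter-all (T? ∘ not ∘ sameEdge p) D-apart ⟩
  D ∎
  where
  open ≡-Reasoning
  D : List _
  D = deduplicateᵇ sameEdge (filterᵇ (not ∘ isLoop) E)
  D-apart : All (T ∘ not ∘ sameEdge p) D
  D-apart = deduplicate⁺ (λ f g → T? (sameEdge f g)) (filter⁺ (T? ∘ not ∘ isLoop) E-apart)

∑-delta : ∀ n (x : Fin n) (f : Fin n → ℕ) → ∑[ c < n ] (if c == x then f c else 0) ≡ f x
∑-delta (suc n) x f = begin
  ∑[ c < suc n ] (if c == x then f c else 0)
    ≡⟨ sum-remove {n} {x} (λ c → if c == x then f c else 0) ⟩
  (if x == x then f x else 0) ℕ.+ (∑[ y < n ] (if punchIn x y == x then f (punchIn x y) else 0))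
    ≡⟨ cong₂ ℕ._+_ (cong (if_then f x else 0) (==-refl x))
                   (sum-cong-≗ λ y → cong (if_then f (punchIn x y) else 0)
                                          (≢⇒==-false (punchInᵢ≢i x y))) ⟩
  f x ℕ.+ (∑[ y < n ] 0)
    ≡⟨ cong (f x ℕ.+_) (sum-replicate-zero n) ⟩
  f x ℕ.+ 0
    ≡⟨ +-identityʳ (f x) ⟩
  f x ∎
  where open ≡-Reasoning

sum-map-tabulate : ∀ {A : Set} n (g : Fin n → A) (f : A → ℕ) →
  sum (map f (tabulate g)) ≡ ∑[ i < n ] f (g i)
sum-map-tabulate zero    g f = refl
sum-map-tabulate (suc n) g f = cong (f (g zero) ℕ.+_) (sum-map-tabulate n (g ∘ suc) f)

count : ∀ {n} k → (Vec (Fin n) k → Bool) → ℕ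
count zero    P = if P [] then 1 else 0
count {n} (suc k) P = ∑[ c < n ] count k (λ κ → P (c ∷ κ))

count-cong : ∀ {n} k {P Q : Vec (Fin n) k → Bool} → (∀ κ → P κ ≡ Q κ) →
  count k P ≡ count k Q
count-cong zero    P≗Q = cong (if_then 1 else 0) (P≗Q [])
count-cong (suc k) P≗Q = sum-cong-≗ λ c → count-cong k (λ κ → P≗Q (c ∷ κ))

count-split : ∀ {n} k (q P : Vec (Fin n) k → Bool) →
  count k P ≡ count k (λ κ → q κ ∧ P κ) ℕ.+ count k (λ κ → not (q κ) ∧ P κ)
count-split zero q P with q []
... | true  = sym (+-identityʳ _)
... | false = refl
count-split (suc k) q P =
  trans (sum-cong-≗ λ c → count-split k (λ κ → q (c ∷ κ)) (λ κ → P (c ∷ κ)))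
        (∑-distrib-+ (λ c → count k (λ κ → q (c ∷ κ) ∧ P (c ∷ κ)))
                     (λ c → count k (λ κ → not (q (c ∷ κ)) ∧ P (c ∷ κ))))

count-insertAt : ∀ {n} k (v : Fin (suc k)) (P : Vec (Fin n) (suc k) → Bool) →
  count (suc k) P ≡ ∑[ c < n ] count k (λ κ → P (insertAt κ v c))
count-insertAt k       zero    P = refl
count-insertAt (suc k) (suc v) P =
  trans (sum-cong-≗ λ d → count-insertAt k v (λ κ → P (d ∷ κ)))
        (∑-comm λ d c → count k (λ κ → P (d ∷ insertAt κ v c)))

∑-count-fibre : ∀ {n} k (g : Vec (Fin n) k → Fin n) (Q : Vec (Fin n) k → Bool) →
  ∑[ c < n ] count k (λ κ → (c == g κ) ∧ Q κ) ≡ count k Q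
∑-count-fibre {n} zero g Q =
  trans (sum-cong-≗ λ c → if-∧ (c == g []) (Q []))
        (∑-delta n (g []) (λ _ → if Q [] then 1 else 0))
  where
  if-∧ : ∀ b q → (if b ∧ q then 1 else 0) ≡ (if b then (if q then 1 else 0) else 0)
  if-∧ true  q = refl
  if-∧ false q = refl
∑-count-fibre (suc k) g Q =
  trans (∑-comm λ c d → count k (λ κ → (c == g (d ∷ κ)) ∧ Q (d ∷ κ)))
        (sum-cong-≗ λ d → ∑-count-fibre k (λ κ → g (d ∷ κ)) (λ κ → Q (d ∷ κ)))

count-coincide : ∀ {n} k (v u : Fin (suc k)) (v≢u : v ≢ u) (P : Vec (Fin n) (suc k) → Bool) →
  count (suc k) (λ κ → (vlookup κ v == vlookup κ u) ∧ P κ)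
    ≡ count k (λ κ → P (insertAt κ v (vlookup κ (punchOut v≢u))))
count-coincide {n} k v u v≢u P = begin
  count (suc k) (λ κ → (vlookup κ v == vlookup κ u) ∧ P κ)
    ≡⟨ count-insertAt k v (λ κ → (vlookup κ v == vlookup κ u) ∧ P κ) ⟩
  ∑[ c < n ] count k (λ κ →
    (vlookup (insertAt κ v c) v == vlookup (insertAt κ v c) u) ∧ P (insertAt κ v c))
    ≡⟨ sum-cong-≗ (λ c → count-cong k λ κ →
         cong (_∧ P (insertAt κ v c)) (cong₂ _==_ (insertAt-lookup κ v c) (lookup-u κ c))) ⟩
  ∑[ c < n ] count k (λ κ → (c == vlookup κ ve) ∧ P (insertAt κ v c))
    ≡⟨ sum-cong-≗ (λ c → count-cong k λ κ →
         ==-∧-subst (λ d → P (insertAt κ v d)) c (vlookup κ ve)) ⟩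
  ∑[ c < n ] count k (λ κ → (c == vlookup κ ve) ∧ P (insertAt κ v (vlookup κ ve)))
    ≡⟨ ∑-count-fibre k (λ κ → vlookup κ ve) _ ⟩
  count k (λ κ → P (insertAt κ v (vlookup κ ve))) ∎
  where
  open ≡-Reasoning
  ve : Fin k
  ve = punchOut v≢u
  lookup-u : ∀ κ c → vlookup (insertAt κ v c) u ≡ vlookup κ ve
  lookup-u κ c = trans (cong (vlookup (insertAt κ v c)) (sym (punchIn-punchOut v≢u)))
                       (insertAt-punchIn κ v c ve)

length-filter-concatMap : ∀ {A B : Set} (P : A → Bool) (F : B → List A) (xs : List B) →
  length (filterᵇ P (concatMap F xs)) ≡ sum (map (λ x → length (filterᵇ P (F x))) xs)
length-filter-concatMap P F []       = refl
length-filter-concatMap P F (x ∷ xs) = begin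
  length (filterᵇ P (F x ++ concatMap F xs))
    ≡⟨ cong length (filter-++ (T? ∘ P) (F x) (concatMap F xs)) ⟩
  length (filterᵇ P (F x) ++ filterᵇ P (concatMap F xs))
    ≡⟨ length-++ (filterᵇ P (F x)) ⟩
  length (filterᵇ P (F x)) ℕ.+ length (filterᵇ P (concatMap F xs))
    ≡⟨ cong (length (filterᵇ P (F x)) ℕ.+_) (length-filter-concatMap P F xs) ⟩
  length (filterᵇ P (F x)) ℕ.+ sum (map (λ y → length (filterᵇ P (F y))) xs) ∎
  where open ≡-Reasoning

length-filter-map : ∀ {A B : Set} (P : B → Bool) (f : A → B) (xs : List A) →
  length (filterᵇ P (map f xs)) ≡ length (filterᵇ (P ∘ f) xs)
length-filter-map P f []       = refl
length-filter-map P f (x ∷ xs) with P (f x)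
... | true  = cong suc (length-filter-map P f xs)
... | false = length-filter-map P f xs

length-filter-allVecs : ∀ n k (P : Vec (Fin n) k → Bool) →
  length (filterᵇ P (allVecs n k)) ≡ count k P
length-filter-allVecs n zero P with P []
... | true  = refl
... | false = refl
length-filter-allVecs n (suc k) P = begin
  length (filterᵇ P (concatMap (λ c → map (c ∷_) (allVecs n k)) (allFin n)))
    ≡⟨ length-filter-concatMap P (λ c → map (c ∷_) (allVecs n k)) (allFin n) ⟩
  sum (map (λ c → length (filterᵇ P (map (c ∷_) (allVecs n k)))) (allFin n))
    ≡⟨ sum-map-tabulate n id _ ⟩
  ∑[ c < n ] length (filterᵇ P (map (c ∷_) (allVecs n k)))
    ≡⟨ sum-cong-≗ (λ c → trans (length-filter-map P (c ∷_) (allVecs n k))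
                               (length-filter-allVecs n k _)) ⟩
  count (suc k) P ∎
  where open ≡-Reasoning

coloured : (G : WGraph) → ∀ {n} → (Fin n → ℕ) → Vec (Fin n) (nv G) → Bool
coloured G a κ = proper G κ ∧ hasMonomial G a κ

X≡count : ∀ G n (a : Fin n → ℕ) → X G n a ≡ + count (nv G) (coloured G a)
X≡count G n a = cong +_ (length-filter-allVecs n (nv G) (coloured G a))

count-+⇒X-+ : ∀ G H K {n} (a : Fin n → ℕ) →
  count (nv G) (coloured G a) ≡ count (nv H) (coloured H a) ℕ.+ count (nv K) (coloured K a) →
  X G n a ≡ X H n a + X K n a
count-+⇒X-+ G H K {n} a eq = begin
  X G n a                             ≡⟨ X≡count G n a ⟩
  + count (nv G) (coloured G a)       ≡⟨ cong +_ eq ⟩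
  + (#H ℕ.+ #K)                       ≡⟨ pos-+ #H #K ⟩
  + #H + + #K                         ≡⟨ sym (cong₂ _+_ (X≡count H n a) (X≡count K n a)) ⟩
  X H n a + X K n a                   ∎
  where
  open ≡-Reasoning
  #H #K : ℕ
  #H = count (nv H) (coloured H a)
  #K = count (nv K) (coloured K a)

X-cong-proper : ∀ k E E′ (ω : Fin k → ℕ) →
  (∀ {n} (κ : Vec (Fin n) k) → all (properEdge κ) E ≡ all (properEdge κ) E′) →
  ∀ n a → X (wgraph k E ω) n a ≡ X (wgraph k E′ ω) n a
X-cong-proper k E E′ ω same n a = trans (X≡count (wgraph k E ω) n a) (trans
  (cong +_ (count-cong k λ κ → cong (_∧ hasMonomial (wgraph k E ω) a κ) (same κ)))
  (sym (X≡count (wgraph k E′ ω) n a)))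

classWeight-∑ : ∀ G {n} (κ : Vec (Fin n) (nv G)) c →
  classWeight G κ c ≡ ∑[ i < nv G ] (if vlookup κ i == c then w G i else 0)
classWeight-∑ G κ c = sum-map-tabulate (nv G) id _

hasMonomial-cong : ∀ G H {n} (a : Fin n → ℕ) κ κ′ →
  (∀ c → classWeight G κ c ≡ classWeight H κ′ c) →
  hasMonomial G a κ ≡ hasMonomial H a κ′
hasMonomial-cong G H {n} a κ κ′ eq = all-cong (λ c → cong (_==ℕ a c) (eq c)) (allFin n)

coloured-cong : ∀ {k E E′} {ω ω′ : Fin k → ℕ} {n} (a : Fin n → ℕ) →
  E ≡ E′ → (∀ i → ω i ≡ ω′ i) →
  ∀ κ → coloured (wgraph k E ω) a κ ≡ coloured (wgraph k E′ ω′) a κ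
coloured-cong {k} {E} {ω = ω} {ω′} a refl ω≗ω′ κ =
  cong (proper (wgraph k E ω) κ ∧_) (hasMonomial-cong (wgraph k E ω) (wgraph k E ω′) a κ κ
    λ c → cong sum (map-cong (λ i → cong (if vlookup κ i == c then_else 0) (ω≗ω′ i)) (allFin k)))

coloured-delete : ∀ G (e : Edge G) {n} (a : Fin n → ℕ) κ →
  coloured G a κ ≡ properEdge κ (endpoints G e) ∧ coloured (delete G e) a κ
coloured-delete G e a κ = trans
  (cong (_∧ hasMonomial G a κ) (all-removeAt (properEdge κ) (edges G) e))
  (∧-assoc (properEdge κ (endpoints G e)) (proper (delete G e) κ) (hasMonomial G a κ))

module Identify {m : ℕ} (u v : Fin (suc m)) (v≢u : v ≢ u) where
  open Contract u v v≢u

  -- contraction G e nl unfolds to identify (removeAt (edges G) e) (w G).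
  identify : List (Fin (suc m) × Fin (suc m)) → (Fin (suc m) → ℕ) → WGraph
  identify E ω = wgraph m (map mergeE E) (wc ω)

  pullback : ∀ {n} → Vec (Fin n) m → Vec (Fin n) (suc m)
  pullback κ = insertAt κ v (vlookup κ ve)

  lookup-pullback : ∀ {n} (κ : Vec (Fin n) m) x → vlookup (pullback κ) x ≡ vlookup κ (mergeV x)
  lookup-pullback κ x with v ≟ x
  ... | yes refl = insertAt-lookup κ v _
  ... | no v≢x   = trans (cong (vlookup (pullback κ)) (sym (punchIn-punchOut v≢x)))
                         (insertAt-punchIn κ v _ _)

  proper-pullback : ∀ E ω {n} (κ : Vec (Fin n) m) →
    proper (wgraph (suc m) E ω) (pullback κ) ≡ proper (identify E ω) κ
  proper-pullback E ω κ = trans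
    (all-cong (λ (a , b) → cong not (cong₂ _==_ (lookup-pullback κ a) (lookup-pullback κ b))) E)
    (sym (all-map (properEdge κ) mergeE E))

  wc-split : ∀ ω y → wc ω y ≡ (if y == ve then ω v else 0) ℕ.+ ω (punchIn v y)
  wc-split ω y with y ≟ ve
  ... | yes refl =
    trans (+-comm (ω u) (ω v)) (cong (ω v ℕ.+_) (cong ω (sym (punchIn-punchOut v≢u))))
  ... | no _     = refl

  classWeight-pullback : ∀ E ω {n} (κ : Vec (Fin n) m) d →
    classWeight (wgraph (suc m) E ω) (pullback κ) d ≡ classWeight (identify E ω) κ d
  classWeight-pullback E ω {n} κ d = begin
    classWeight (wgraph (suc m) E ω) (pullback κ) d
      ≡⟨ classWeight-∑ (wgraph (suc m) E ω) (pullback κ) d ⟩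
    ∑[ i < suc m ] inClass (pullback κ) ω i
      ≡⟨ sum-remove {m} {v} (inClass (pullback κ) ω) ⟩
    inClass (pullback κ) ω v ℕ.+ (∑[ y < m ] inClass (pullback κ) ω (punchIn v y))
      ≡⟨ cong₂ ℕ._+_
           (trans (cong (if_then ω v else 0) (cong (_== d) (insertAt-lookup κ v _)))
                  (sym (∑-delta m ve (inClass κ (λ _ → ω v)))))
           (sum-cong-≗ λ y → cong (if_then ω (punchIn v y) else 0)
                                  (cong (_== d) (insertAt-punchIn κ v _ y))) ⟩
    (∑[ y < m ] atVe y) ℕ.+ (∑[ y < m ] inClass κ (ω ∘ punchIn v) y)
      ≡⟨ sym (∑-distrib-+ atVe (inClass κ (ω ∘ punchIn v))) ⟩
    ∑[ y < m ] (atVe y ℕ.+ inClass κ (ω ∘ punchIn v) y)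
      ≡⟨ sum-cong-≗ (λ y → trans (if-+ (vlookup κ y == d) (y == ve))
                                 (cong (if vlookup κ y == d then_else 0) (sym (wc-split ω y)))) ⟩
    ∑[ y < m ] inClass κ (wc ω) y
      ≡⟨ sym (classWeight-∑ (identify E ω) κ d) ⟩
    classWeight (identify E ω) κ d ∎
    where
    open ≡-Reasoning
    inClass : ∀ {k} → Vec (Fin n) k → (Fin k → ℕ) → Fin k → ℕ
    inClass κ ω i = if vlookup κ i == d then ω i else 0
    atVe : Fin m → ℕ
    atVe y = if y == ve then inClass κ (λ _ → ω v) y else 0
    if-+ : ∀ b c {x y} → (if c then (if b then y else 0) else 0) ℕ.+ (if b then x else 0)
                       ≡ (if b then (if c then y else 0) ℕ.+ x else 0)
    if-+ true  true  = refl
    if-+ true  false = refl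
    if-+ false true  = refl
    if-+ false false = refl

  count-identify : ∀ E ω {n} (a : Fin n → ℕ) →
    count (suc m) (λ κ → (vlookup κ v == vlookup κ u) ∧ coloured (wgraph (suc m) E ω) a κ)
      ≡ count m (coloured (identify E ω) a)
  count-identify E ω a = trans (count-coincide m v u v≢u (coloured (wgraph (suc m) E ω) a))
    (count-cong m λ κ → cong₂ _∧_ (proper-pullback E ω κ)
      (hasMonomial-cong (wgraph (suc m) E ω) (identify E ω) a (pullback κ) κ
                        (classWeight-pullback E ω κ)))

  count-split-identify : ∀ E ω {n} (a : Fin n → ℕ) →
    count (suc m) (coloured (wgraph (suc m) E ω) a)
      ≡ count m (coloured (identify E ω) a)
        ℕ.+ count (suc m) (λ κ → properEdge κ (v , u) ∧ coloured (wgraph (suc m) E ω) a κ)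
  count-split-identify E ω a = trans
    (count-split (suc m) (λ κ → vlookup κ v == vlookup κ u) (coloured (wgraph (suc m) E ω) a))
    (cong (ℕ._+ _) (count-identify E ω a))

module _ {m : ℕ} (u v : Fin (suc m)) (v≢u : v ≢ u) where
  open Contract u v v≢u

  mergeV-fibres : ∀ a b → mergeV a ≡ mergeV b →
    a ≡ b ⊎ (a ≡ v × b ≡ u) ⊎ (a ≡ u × b ≡ v)
  mergeV-fibres a b eq with v ≟ a | v ≟ b
  ... | yes v≡a | yes v≡b = inj₁ (trans (sym v≡a) v≡b)
  ... | yes v≡a | no v≢b  = inj₂ (inj₁ (sym v≡a , sym (punchOut-injective v≢u v≢b eq)))
  ... | no v≢a  | yes v≡b = inj₂ (inj₂ (punchOut-injective v≢a v≢u eq , sym v≡b))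
  ... | no v≢a  | no v≢b  = inj₁ (punchOut-injective v≢a v≢b eq)

  -- v'' has weight 1 and v_e weight (ω u + ω v) ∸ 1 in (G,ω) ⊙ e; the truncated subtraction
  -- is undone only when ω u + ω v ≥ 1.
  wc-wn : ∀ ω → 1 ≤ ω u ℕ.+ ω v → ∀ y →
    Contract.wc (suc ve) zero (λ ()) (wn ω) y ≡ wc ω y
  wc-wn ω 1≤s y with y ≟ ve
  ... | yes refl rewrite ==-refl ve = m∸n+n≡m 1≤s
  ... | no _     = refl

module _ {m : ℕ} (E : List (Fin (suc m) × Fin (suc m))) (ω : Fin (suc m) → ℕ)
         (e : Fin (length E)) (nl : NonLoop (wgraph (suc m) E ω) e) where
  private
    G : WGraph
    G = wgraph (suc m) E ω
    u v : Fin (suc m)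
    u = proj₂ (lookup E e)
    v = proj₁ (lookup E e)
  open Contract u v nl
  private
    C NC NC⁻ : WGraph
    C   = contraction G e nl
    NC  = nearContraction G e nl
    NC⁻ = nearContractionMinusℓ G e nl

  X-delete : ∀ n (a : Fin n → ℕ) → X (delete G e) n a ≡ X C n a + X G n a
  X-delete n a = count-+⇒X-+ (delete G e) C G a (trans
    (Identify.count-split-identify u v nl (removeAt E e) ω a)
    (cong (count m (coloured C a) ℕ.+_) (sym (count-cong (suc m) (coloured-delete G e a)))))

  -- Identifying v'' = zero with v_e = suc ve turns ((G,ω) ⊙ e) \ ℓ_e back into G/e.
  X-nearContractionMinusℓ : PositiveWeights G → ∀ n (a : Fin n → ℕ) →
    X NC⁻ n a ≡ X C n a + X NC n a
  X-nearContractionMinusℓ pos n a = count-+⇒X-+ NC⁻ C NC a (trans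
    (Identify.count-split-identify (suc ve) zero (λ ()) (edges NC⁻) (wn ω) a)
    (cong₂ ℕ._+_
      (count-cong m (coloured-cong a (sym (map-∘ (removeAt E e))) (wc-wn u v nl ω 1≤s)))
      (count-cong (suc m) pendant-first)))
    where
    1≤s : 1 ≤ ω u ℕ.+ ω v
    1≤s = ≤-trans (pos u) (m≤m+n (ω u) (ω v))
    pendant-first : ∀ (κ : Vec (Fin n) (suc m)) →
      properEdge κ (zero , suc ve) ∧ coloured NC⁻ a κ ≡ coloured NC a κ
    pendant-first κ = trans
      (cong (λ b → not b ∧ coloured NC⁻ a κ) (==-sym (vlookup κ zero) (vlookup κ (suc ve))))
      (sym (∧-assoc (properEdge κ ℓ) (proper NC⁻ κ) (hasMonomial NC⁻ a κ)))

  nearContractionMinusℓ-loopless : Simple G → All (T ∘ not ∘ isLoop) (edges NC⁻)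
  nearContractionMinusℓ-loopless (loopless , no-parallel) = map⁺ (all-removeAt⁺ E e merged-nonLoop)
    where
    merged-nonLoop : ∀ j → j ≢ e → T (not (isLoop (shift (mergeE (lookup E j)))))
    merged-nonLoop j j≢e = subst (T ∘ not) (sym (==-suc (mergeV a) (mergeV b)))
                                 (≢⇒T-not-== (fibre-absurd ∘ mergeV-fibres u v nl a b))
      where
      a b : Fin (suc m)
      a = proj₁ (lookup E j)
      b = proj₂ (lookup E j)
      not-parallel : ∀ {x y} → x ≡ a → y ≡ b → ¬ T (sameEdge (v , u) (x , y))
      not-parallel refl refl = subst T (no-parallel e j (j≢e ∘ sym))
      fibre-absurd : ¬ (a ≡ b ⊎ (a ≡ v × b ≡ u) ⊎ (a ≡ u × b ≡ v))
      fibre-absurd (inj₁ a≡b)                = loopless j a≡b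
      fibre-absurd (inj₂ (inj₁ (a≡v , b≡u))) = not-parallel (sym a≡v) (sym b≡u) (sameEdge-refl v u)
      fibre-absurd (inj₂ (inj₂ (a≡u , b≡v))) = not-parallel (sym a≡u) (sym b≡v) (sameEdge-flip v u)

  pendant-apart : All (T ∘ not ∘ sameEdge ℓ) (edges NC⁻)
  pendant-apart = map⁺ (All.universal (λ f → apart (mergeE f)) (removeAt E e))
    where
    -- v'' = zero is an endpoint of no other edge, so both conjunctions contain zero == suc _.
    apart : ∀ f → T (not (sameEdge ℓ (shift f)))
    apart (a , b) rewrite ∧-zeroʳ (suc ve == suc a) | ∧-zeroʳ (suc ve == suc b) = tt

  X-simp-nearContraction : Simple G → ∀ n (a : Fin n → ℕ) → X (simp NC) n a ≡ X NC n a
  X-simp-nearContraction simple = X-cong-proper (suc m) (edges (simp NC)) (edges NC) (wn ω) λ κ →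
    proper-simp NC κ (tt ∷ nearContractionMinusℓ-loopless simple)

  X-deletePair-simp-nearContraction : Simple G → ∀ n (a : Fin n → ℕ) →
    X (deletePair (simp NC) (ℓ-ends G e nl)) n a ≡ X NC⁻ n a
  X-deletePair-simp-nearContraction simple =
    X-cong-proper (suc m) (edges (deletePair (simp NC) ℓ)) (edges NC⁻) (wn ω) λ κ → trans
      (cong (all (properEdge κ)) (deletePair-simp-cons (suc m) ℓ (edges NC⁻) (wn ω) tt pendant-apart))
      (proper-simp NC⁻ κ (nearContractionMinusℓ-loopless simple))

x≡[x+y]-y : ∀ (x y : ℤ) → x ≡ (x + y) - y
x≡[x+y]-y = solve-∀

x≡[c+x]-[c+y]+y : ∀ (c x y : ℤ) → x ≡ ((c + x) - (c + y)) + y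
x≡[c+x]-[c+y]+y = solve-∀

proposition3p2 : (G : WGraph) → PositiveWeights G → (e : Edge G) → (nl : NonLoop G e) →
    ((n : ℕ) (a : Fin n → ℕ) →
       X (contraction G e nl) n a ≡ X (nearContractionMinusℓ G e nl) n a - X (nearContraction G e nl) n a)
    × ((n : ℕ) (a : Fin n → ℕ) →
       X G n a ≡ (X (delete G e) n a - X (nearContractionMinusℓ G e nl) n a) + X (nearContraction G e nl) n a)
    × (Simple G → (n : ℕ) (a : Fin n → ℕ) →
       X G n a ≡ (X (delete G e) n a
                   - X (deletePair (simp (nearContraction G e nl)) (ℓ-ends G e nl)) n a)
                 + X (simp (nearContraction G e nl)) n a)
proposition3p2 (wgraph zero E ω) _ e _ with proj₁ (lookup E e)
... | ()
proposition3p2 G@(wgraph (suc m) E ω) pos e nl = contraction-formula , deletion-formula , simple-formula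
  where
  C NC NC⁻ : WGraph
  C   = contraction G e nl
  NC  = nearContraction G e nl
  NC⁻ = nearContractionMinusℓ G e nl

  contraction-formula : ∀ n a → X C n a ≡ X NC⁻ n a - X NC n a
  contraction-formula n a = trans (x≡[x+y]-y (X C n a) (X NC n a))
    (cong (_- X NC n a) (sym (X-nearContractionMinusℓ E ω e nl pos n a)))

  deletion-formula : ∀ n a → X G n a ≡ (X (delete G e) n a - X NC⁻ n a) + X NC n a
  deletion-formula n a = trans (x≡[c+x]-[c+y]+y (X C n a) (X G n a) (X NC n a))
    (cong₂ (λ p q → (p - q) + X NC n a)
           (sym (X-delete E ω e nl n a)) (sym (X-nearContractionMinusℓ E ω e nl pos n a)))

  simple-formula : Simple G → ∀ n a →
    X G n a ≡ (X (delete G e) n a - X (deletePair (simp NC) (ℓ-ends G e nl)) n a) + X (simp NC) n a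
  simple-formula simple n a = trans (deletion-formula n a)
    (cong₂ (λ p q → (X (delete G e) n a - p) + q)
           (sym (X-deletePair-simp-nearContraction E ω e nl simple n a))
           (sym (X-simp-nearContraction E ω e nl simple n a)))
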